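{- Let $I$ be an arbitrary instance of $\text{NKP}^c$ or $\text{NKP}^u$ and let $e_{ik}\in M$. If $p_{ik}\le R\left(t_{\{e_{ik}\}}-t_{\emptyset}\right)$, then $e_{ik}$ is an unprofitable item, i.e. for every subset $O\subseteq M\setminus\{e_{ik}\}$ with $w_{ik}+\sum_{e_{jl}\in O}w_{jl}\le W$ we have $f(O\cup\{e_{ik}\})\le f(O)$.
   Context: An instance consists of a route of $n+1$ distinct cities $1,\dots,n+1$ visited in this order, distances $d_i>0$ between cities $i$ and $i+1$ ($1\le i\le n$), and for each city $i\le n$ a set of items $M_i=\{e_{i1},\dots,e_{im_i}\}$; $M=\bigcup_{i=1}^n M_i$. Each item $e_{ik}$ has a positive integer profit $p_{ik}$ and a nonnegative weight $w_{ik}$. Further given are a capacity $W$, velocities $0<\upsilon_{\min}<\upsilon_{\max}$, a rent rate $R>0$, and $\nu=(\upsilon_{\max}-\upsilon_{\min})/W$. A selection $O\subseteq M$ is feasible if $\sum_{e_{jl}\in O}w_{jl}\le W$ ($\text{NKP}^c$); in $\text{NKP}^u$ additionally $W\ge\sum_{e_{ik}\in M}w_{ik}$. For $O\subseteq M$ let $O_j=O\cap M_j$ and define the total travel time $$t_O=\sum_{i=1}^n \frac{d_i}{\upsilon_{\max}-\nu\sum_{j=1}^i\sum_{e_{jk}\in O_j} w_{jk}},$$ and the objective value $f(O)=\sum_{e_{jl}\in O}p_{jl}-R\,t_O$. An item is called unprofitable if its inclusion in any (feasible) packing plan does not increase the objective value.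
   Formalization: The distances $d_i$, item weights $w_{ik}$, capacity $W$, velocities $\upsilon_{\min}$ and $\upsilon_{\max}$, and rent rate $R$ are all rational numbers. -}

module Defs where

open import Data.Nat as ℕ using (ℕ; zero; suc)
open import Data.Fin as Fin using (Fin; toℕ)
open import Data.Fin.Properties as FinP using ()
open import Data.Bool using (Bool; true; false; if_then_else_; _∧_; _∨_)
open import Data.Integer using (+_)
open import Data.Rational using (ℚ; 0ℚ; _+_; _-_; _*_; _÷_; _≤_; _<_; _/_; ≢-nonZero)
open import Data.Rational.Properties as ℚP using ()
open import Relation.Nullary using (yes; no)
open import Relation.Nullary.Decidable using (⌊_⌋)

∑ : (n : ℕ) → (Fin n → ℚ) → ℚ
∑ zero    f = 0ℚ
∑ (suc n) f = f Fin.zero + ∑ n (λ i → f (Fin.suc i))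

-- Total division: x ⊘ y = x / y if y ≠ 0, and 0 otherwise.
-- (Only ever applied to positive denominators in the theorem.)
_⊘_ : ℚ → ℚ → ℚ
x ⊘ y with y ℚP.≟ 0ℚ
... | yes _  = 0ℚ
... | no y≢0 = _÷_ x y {{≢-nonZero y≢0}}

ℕ→ℚ : ℕ → ℚ
ℕ→ℚ k = + k / 1

-- An instance of the nonlinear knapsack problem NKP^c:
-- route with n+1 cities, distances d_i (i = 1..n, here Fin n),
-- at each city i (Fin n) a set of m i items.
record Instance : Set where
  field
    n        : ℕ
    d        : Fin n → ℚ
    d-pos    : ∀ i → 0ℚ < d i
    m        : Fin n → ℕ
    p        : (i : Fin n) → Fin (m i) → ℕ
    p-pos    : ∀ i k → 0 ℕ.< p i k
    w        : (i : Fin n) → Fin (m i) → ℚ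
    w-nonneg : ∀ i k → 0ℚ ≤ w i k
    W        : ℚ
    W-pos    : 0ℚ < W
    vmin     : ℚ
    vmax     : ℚ
    vmin-pos : 0ℚ < vmin
    vmin<vmax : vmin < vmax
    R        : ℚ
    R-pos    : 0ℚ < R

  ν : ℚ
  ν = (vmax - vmin) ⊘ W

  Selection : Set
  Selection = (i : Fin n) → Fin (m i) → Bool

  ∅ : Selection
  ∅ _ _ = false

  isItem : (i : Fin n) (k : Fin (m i)) → Selection
  isItem i k j l = ⌊ j FinP.≟ i ⌋ ∧ ⌊ toℕ l ℕ.≟ toℕ k ⌋

  insert : Selection → (i : Fin n) → Fin (m i) → Selection
  insert O i k j l = O j l ∨ isItem i k j l

  cityWeight : Selection → Fin n → ℚ
  cityWeight O j = ∑ (m j) (λ l → if O j l then w j l else 0ℚ)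

  weight : Selection → ℚ
  weight O = ∑ n (cityWeight O)

  profit : Selection → ℚ
  profit O = ∑ n (λ j → ∑ (m j) (λ l → if O j l then ℕ→ℚ (p j l) else 0ℚ))

  cumWeight : Selection → Fin n → ℚ
  cumWeight O i = ∑ n (λ j → if ⌊ toℕ j ℕ.≤? toℕ i ⌋ then cityWeight O j else 0ℚ)

  t : Selection → ℚ
  t O = ∑ n (λ i → d i ⊘ (vmax - ν * cumWeight O i))

  f : Selection → ℚ
  f O = profit O - R * t O

module Submission where

-- Adding item e to a packing O (with e ∉ O) changes the objective by
-- p_e − R (t_{O∪{e}} − t_O).  The heart of the proof is that the travel time
-- is supermodular on disjoint selections:
--     t_A + t_B ≤ t_{A∪B} + t_∅   whenever A ∩ B = ∅ and w(A∪B) ≤ W.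
-- With A = O and B = {e} this says t_{e} − t_∅ ≤ t_{O∪{e}} − t_O, so the
-- hypothesis p_e ≤ R (t_{e} − t_∅) yields f(O ∪ {e}) ≤ f(O).
--
-- Supermodularity is proved leg by leg.  The cumulative weight carried on a
-- leg is additive over disjoint selections, and the leg time d / (u − νc)
-- satisfies the "increasing increments" inequality of the reciprocal
--     d/(u−α) + d/(u−β) ≤ d/(u−α−β) + d/u     (α, β ≥ 0, u−α−β > 0),
-- which is shown by clearing the four positive denominators.

open import Defs
open import Data.Fin using (Fin)
open import Data.Bool using (false)
open import Data.Rational using (_+_; _-_; _*_; _≤_)
open import Relation.Binary.PropositionalEquality using (_≡_)

open import Data.Nat as ℕ using (zero; suc)
open import Data.Fin as Fin using (toℕ)
open import Data.Fin.Properties as FinP using (toℕ-injective; suc-injective)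
open import Data.Bool using (Bool; true; if_then_else_; _∨_)
open import Data.Empty using (⊥; ⊥-elim)
open import Data.Rational
  using (ℚ; 0ℚ; 1ℚ; -_; 1/_; _<_; _≟_; positive; nonNegative; ≢-nonZero)
open import Data.Rational.Properties
open import Data.Rational.Solver using (module +-*-Solver)
open import Relation.Binary.PropositionalEquality
  using (refl; sym; trans; cong; cong₂; subst; subst₂; _≢_; module ≡-Reasoning)
open import Relation.Binary.Definitions using (DecidableEquality)
open import Relation.Nullary using (yes; no)
open import Relation.Nullary.Decidable using (⌊_⌋)

open +-*-Solver using (solve; _:=_; _:+_; _:*_; _:-_)

0≤-⇒≤ : ∀ a b → 0ℚ ≤ b - a → a ≤ b
0≤-⇒≤ a b h =
  subst₂ _≤_ (+-identityʳ a) (solve 2 (λ a b → a :+ (b :- a) := b) refl a b)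
    (+-monoʳ-≤ a h)

≤⇒0≤- : ∀ a b → a ≤ b → 0ℚ ≤ b - a
≤⇒0≤- a b h = subst (_≤ b - a) (+-inverseʳ a) (+-monoˡ-≤ (- a) h)

<⇒0<- : ∀ a b → a < b → 0ℚ < b - a
<⇒0<- a b h = subst (_< b - a) (+-inverseʳ a) (+-monoˡ-< (- a) h)

0≤* : ∀ {x y} → 0ℚ ≤ x → 0ℚ ≤ y → 0ℚ ≤ x * y
0≤* {x} {y} hx hy =
  nonNegative⁻¹ _ {{nonNeg*nonNeg⇒nonNeg x {{nonNegative hx}} y {{nonNegative hy}}}}

0≤+ : ∀ {x y} → 0ℚ ≤ x → 0ℚ ≤ y → 0ℚ ≤ x + y
0≤+ {x} {y} hx hy = subst (_≤ x + y) (+-identityʳ 0ℚ) (+-mono-≤ hx hy)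

0<⇒≢0 : ∀ {x} → 0ℚ < x → x ≢ 0ℚ
0<⇒≢0 h refl = <-irrefl refl h

⊘-cancel : ∀ d x → 0ℚ < x → x * (d ⊘ x) ≡ d
⊘-cancel d x 0<x with x ≟ 0ℚ
... | yes x≡0 = ⊥-elim (0<⇒≢0 0<x x≡0)
... | no x≢0 = begin
  x * (d * 1/x)   ≡⟨ solve 3 (λ x d y → x :* (d :* y) := d :* (x :* y)) refl x d 1/x ⟩
  d * (x * 1/x)   ≡⟨ cong (d *_) (*-inverseʳ x {{≢-nonZero x≢0}}) ⟩
  d * 1ℚ          ≡⟨ *-identityʳ d ⟩
  d               ∎
  where
  open ≡-Reasoning
  1/x = (1/ x) {{≢-nonZero x≢0}}

⊘-nonneg : ∀ d x → 0ℚ ≤ d → 0ℚ < x → 0ℚ ≤ d ⊘ x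
⊘-nonneg d x 0≤d 0<x with x ≟ 0ℚ
... | yes x≡0 = ⊥-elim (0<⇒≢0 0<x x≡0)
... | no x≢0 = 0≤* 0≤d (<⇒≤ (positive⁻¹ _ {{1/pos⇒pos x {{positive 0<x}}}}))

⊘-sum-cleared : ∀ d x y K → 0ℚ < x → 0ℚ < y →
  (d ⊘ x + d ⊘ y) * (x * y * K) ≡ d * (y * K + x * K)
⊘-sum-cleared d x y K 0<x 0<y = begin
  (d ⊘ x + d ⊘ y) * (x * y * K)
    ≡⟨ solve 5 (λ qx qy x y K → (qx :+ qy) :* (x :* y :* K)
                   := (x :* qx) :* (y :* K) :+ (y :* qy) :* (x :* K))
             refl (d ⊘ x) (d ⊘ y) x y K ⟩
  (x * (d ⊘ x)) * (y * K) + (y * (d ⊘ y)) * (x * K)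
    ≡⟨ cong₂ (λ a b → a * (y * K) + b * (x * K)) (⊘-cancel d x 0<x) (⊘-cancel d y 0<y) ⟩
  d * (y * K) + d * (x * K)
    ≡⟨ sym (*-distribˡ-+ d (y * K) (x * K)) ⟩
  d * (y * K + x * K) ∎
  where open ≡-Reasoning

-- d/(u−α) + d/(u−β) ≤ d/(u−α−β) + d/u for d, α, β ≥ 0 and u − α − β > 0.
-- After multiplying by D = (u−α)(u−β)(u−α−β)u > 0 the two sides differ by
-- d·α·β·(u + (u−α−β)) ≥ 0.
reciprocal-increments : ∀ d u α β → 0ℚ ≤ d → 0ℚ ≤ α → 0ℚ ≤ β → 0ℚ < u - (α + β) →
  d ⊘ (u - α) + d ⊘ (u - β) ≤ d ⊘ (u - (α + β)) + d ⊘ u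
reciprocal-increments d u α β 0≤d 0≤α 0≤β 0<S =
  *-cancelʳ-≤-pos D {{positive 0<D}} (0≤-⇒≤ _ _ (subst (0ℚ ≤_) (sym gap) 0≤gap))
  where
  S = u - (α + β)
  P = u - α
  Q = u - β
  below : ∀ a γ → 0ℚ ≤ γ → 0ℚ < a - γ → 0ℚ < a
  below a γ 0≤γ 0<a-γ = <-≤-trans 0<a-γ
    (0≤-⇒≤ _ _ (subst (0ℚ ≤_) (solve 2 (λ a γ → γ := a :- (a :- γ)) refl a γ) 0≤γ))
  0<P : 0ℚ < P
  0<P = below P β 0≤β (subst (0ℚ <_) (solve 3 (λ u α β → u :- (α :+ β) := (u :- α) :- β) refl u α β) 0<S)
  0<Q : 0ℚ < Q
  0<Q = below Q α 0≤α (subst (0ℚ <_) (solve 3 (λ u α β → u :- (α :+ β) := (u :- β) :- α) refl u α β) 0<S)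
  0<u : 0ℚ < u
  0<u = below u α 0≤α 0<P
  0<D : 0ℚ < P * Q * (S * u)
  0<D = positive⁻¹ _ {{pos*pos⇒pos (P * Q) {{pos*pos⇒pos P {{positive 0<P}} Q {{positive 0<Q}}}}
                                    (S * u) {{pos*pos⇒pos S {{positive 0<S}} u {{positive 0<u}}}}}}
  D = P * Q * (S * u)
  gap : (d ⊘ S + d ⊘ u) * D - (d ⊘ P + d ⊘ Q) * D ≡ d * α * β * (u + S)
  gap = begin
    (d ⊘ S + d ⊘ u) * D - (d ⊘ P + d ⊘ Q) * D
      ≡⟨ cong (λ z → (d ⊘ S + d ⊘ u) * z - (d ⊘ P + d ⊘ Q) * D) (*-comm (P * Q) (S * u)) ⟩
    (d ⊘ S + d ⊘ u) * (S * u * (P * Q)) - (d ⊘ P + d ⊘ Q) * D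
      ≡⟨ cong₂ _-_ (⊘-sum-cleared d S u (P * Q) 0<S 0<u) (⊘-sum-cleared d P Q (S * u) 0<P 0<Q) ⟩
    d * (u * (P * Q) + S * (P * Q)) - d * (Q * (S * u) + P * (S * u))
      ≡⟨ solve 4 (λ d u α β →
           d :* (u :* ((u :- α) :* (u :- β)) :+ (u :- (α :+ β)) :* ((u :- α) :* (u :- β)))
             :- d :* ((u :- β) :* ((u :- (α :+ β)) :* u) :+ (u :- α) :* ((u :- (α :+ β)) :* u))
           := d :* α :* β :* (u :+ (u :- (α :+ β)))) refl d u α β ⟩
    d * α * β * (u + S) ∎
    where open ≡-Reasoning
  0≤gap : 0ℚ ≤ d * α * β * (u + S)
  0≤gap = 0≤* (0≤* (0≤* 0≤d 0≤α) 0≤β) (0≤+ (<⇒≤ 0<u) (<⇒≤ 0<S))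

∑-cong : ∀ n {f g : Fin n → ℚ} → (∀ i → f i ≡ g i) → ∑ n f ≡ ∑ n g
∑-cong zero    h = refl
∑-cong (suc n) h = cong₂ _+_ (h Fin.zero) (∑-cong n (λ i → h (Fin.suc i)))

∑-+ : ∀ n (f g : Fin n → ℚ) → ∑ n (λ i → f i + g i) ≡ ∑ n f + ∑ n g
∑-+ zero    f g = sym (+-identityʳ 0ℚ)
∑-+ (suc n) f g = begin
  (f₀ + g₀) + ∑ n (λ i → f (Fin.suc i) + g (Fin.suc i))
    ≡⟨ cong ((f₀ + g₀) +_) (∑-+ n (λ i → f (Fin.suc i)) (λ i → g (Fin.suc i))) ⟩
  (f₀ + g₀) + (F + G)
    ≡⟨ solve 4 (λ a b c d → (a :+ b) :+ (c :+ d) := (a :+ c) :+ (b :+ d)) refl f₀ g₀ F G ⟩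
  (f₀ + F) + (g₀ + G) ∎
  where
  open ≡-Reasoning
  f₀ = f Fin.zero
  g₀ = g Fin.zero
  F = ∑ n (λ i → f (Fin.suc i))
  G = ∑ n (λ i → g (Fin.suc i))

∑-zero : ∀ n {f : Fin n → ℚ} → (∀ i → f i ≡ 0ℚ) → ∑ n f ≡ 0ℚ
∑-zero zero    h = refl
∑-zero (suc n) h = trans (cong₂ _+_ (h Fin.zero) (∑-zero n (λ i → h (Fin.suc i)))) (+-identityʳ 0ℚ)

∑-mono : ∀ n {f g : Fin n → ℚ} → (∀ i → f i ≤ g i) → ∑ n f ≤ ∑ n g
∑-mono zero    h = ≤-refl
∑-mono (suc n) h = +-mono-≤ (h Fin.zero) (∑-mono n (λ i → h (Fin.suc i)))

∑-nonneg : ∀ n {f : Fin n → ℚ} → (∀ i → 0ℚ ≤ f i) → 0ℚ ≤ ∑ n f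
∑-nonneg n {f} h = subst (_≤ ∑ n f) (∑-zero n {λ _ → 0ℚ} (λ _ → refl)) (∑-mono n h)

∑-indicator : ∀ n (c : Fin n → Bool) (i : Fin n) → c i ≡ true → (∀ j → c j ≡ true → j ≡ i) →
  (g : Fin n → ℚ) → ∑ n (λ j → if c j then g j else 0ℚ) ≡ g i
∑-indicator (suc n) c Fin.zero ci≡true unique g rewrite ci≡true =
  trans (cong (g Fin.zero +_) (∑-zero n off)) (+-identityʳ _)
  where
  off : ∀ j → (if c (Fin.suc j) then g (Fin.suc j) else 0ℚ) ≡ 0ℚ
  off j with c (Fin.suc j) in eq
  ... | true with unique (Fin.suc j) eq
  ...   | ()
  off j | false = refl
∑-indicator (suc n) c (Fin.suc i) ci≡true unique g with c Fin.zero in eq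
... | true with unique Fin.zero eq
...   | ()
∑-indicator (suc n) c (Fin.suc i) ci≡true unique g | false =
  trans (+-identityˡ _)
    (∑-indicator n (λ j → c (Fin.suc j)) i ci≡true
      (λ j h → suc-injective (unique (Fin.suc j) h)) (λ j → g (Fin.suc j)))

if-∨ : ∀ (b c : Bool) (x : ℚ) → (b ≡ true → c ≡ true → ⊥) →
  (if b ∨ c then x else 0ℚ) ≡ (if b then x else 0ℚ) + (if c then x else 0ℚ)
if-∨ true  true  x disj = ⊥-elim (disj refl refl)
if-∨ true  false x disj = sym (+-identityʳ x)
if-∨ false true  x disj = sym (+-identityˡ x)
if-∨ false false x disj = sym (+-identityʳ 0ℚ)

if-+ : ∀ (b : Bool) (x y : ℚ) →
  (if b then x + y else 0ℚ) ≡ (if b then x else 0ℚ) + (if b then y else 0ℚ)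
if-+ true  x y = refl
if-+ false x y = sym (+-identityʳ 0ℚ)

if-zero : ∀ (b : Bool) → (if b then 0ℚ else 0ℚ) ≡ 0ℚ
if-zero true  = refl
if-zero false = refl

if-≤ : ∀ (b : Bool) (x : ℚ) → 0ℚ ≤ x → (if b then x else 0ℚ) ≤ x
if-≤ true  x 0≤x = ≤-refl
if-≤ false x 0≤x = 0≤x

if-nonneg : ∀ (b : Bool) (x : ℚ) → 0ℚ ≤ x → 0ℚ ≤ (if b then x else 0ℚ)
if-nonneg true  x 0≤x = 0≤x
if-nonneg false x 0≤x = ≤-refl

≟-refl : ∀ {A : Set} (_≟′_ : DecidableEquality A) (x : A) → ⌊ x ≟′ x ⌋ ≡ true
≟-refl _≟′_ x with x ≟′ x
... | yes _  = refl
... | no x≢x = ⊥-elim (x≢x refl)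

≟-true : ∀ {A : Set} (_≟′_ : DecidableEquality A) {y : A} (x : A) → ⌊ x ≟′ y ⌋ ≡ true → x ≡ y
≟-true _≟′_ {y} x h with x ≟′ y
... | yes x≡y = x≡y
≟-true _≟′_ {y} x () | no _

true≢false : true ≡ false → ⊥
true≢false ()

module Selections (I : Instance) where
  open Instance I

  citySum : Selection → ((j : Fin n) → Fin (m j) → ℚ) → Fin n → ℚ
  citySum S a j = ∑ (m j) (λ l → if S j l then a j l else 0ℚ)

  Sum : Selection → ((j : Fin n) → Fin (m j) → ℚ) → ℚ
  Sum S a = ∑ n (citySum S a)

  -- Union of selections; Defs' insert O i k is, by definition, O ∪ isItem i k.
  _∪_ : Selection → Selection → Selection
  (A ∪ B) j l = A j l ∨ B j l

  Disjoint : Selection → Selection → Set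
  Disjoint A B = ∀ j l → A j l ≡ true → B j l ≡ true → ⊥

  disjoint-item : ∀ i k (O : Selection) → O i k ≡ false → Disjoint O (isItem i k)
  disjoint-item i k O Oik≡false j l Ojl≡true item with j FinP.≟ i | toℕ l ℕ.≟ toℕ k
  ... | yes refl | yes l≡k rewrite toℕ-injective l≡k = true≢false (trans (sym Ojl≡true) Oik≡false)
  ... | yes _    | no _  = true≢false (sym item)
  ... | no _     | _     = true≢false (sym item)

  citySum-∪ : ∀ {A B} → Disjoint A B → ∀ a j → citySum (A ∪ B) a j ≡ citySum A a j + citySum B a j
  citySum-∪ {A} {B} disj a j =
    trans (∑-cong (m j) (λ l → if-∨ (A j l) (B j l) (a j l) (disj j l))) (∑-+ (m j) _ _)

  Sum-∪ : ∀ {A B} → Disjoint A B → ∀ a → Sum (A ∪ B) a ≡ Sum A a + Sum B a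
  Sum-∪ disj a = trans (∑-cong n (citySum-∪ disj a)) (∑-+ n _ _)

  Sum-item : ∀ i k a → Sum (isItem i k) a ≡ a i k
  Sum-item i k a = begin
    Sum (isItem i k) a
      ≡⟨ ∑-cong n only-city-i ⟩
    ∑ n (λ j → if ⌊ j FinP.≟ i ⌋ then citySum (isItem i k) a j else 0ℚ)
      ≡⟨ ∑-indicator n (λ j → ⌊ j FinP.≟ i ⌋) i (≟-refl FinP._≟_ i) (≟-true FinP._≟_) _ ⟩
    citySum (isItem i k) a i
      ≡⟨ at-city-i ⟩
    a i k ∎
    where
    open ≡-Reasoning
    only-city-i : ∀ j → citySum (isItem i k) a j ≡ (if ⌊ j FinP.≟ i ⌋ then citySum (isItem i k) a j else 0ℚ)
    only-city-i j with j FinP.≟ i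
    ... | yes _ = refl
    ... | no _  = ∑-zero (m j) (λ l → refl)
    at-city-i : citySum (isItem i k) a i ≡ a i k
    at-city-i with i FinP.≟ i
    ... | no i≢i = ⊥-elim (i≢i refl)
    ... | yes _  = ∑-indicator (m i) (λ l → ⌊ toℕ l ℕ.≟ toℕ k ⌋) k (≟-refl ℕ._≟_ (toℕ k))
                     (λ l h → toℕ-injective (≟-true ℕ._≟_ (toℕ l) h)) (a i)

  cityWeight-nonneg : ∀ S j → 0ℚ ≤ cityWeight S j
  cityWeight-nonneg S j = ∑-nonneg (m j) (λ l → if-nonneg (S j l) (w j l) (w-nonneg j l))

  cumWeight-nonneg : ∀ S i → 0ℚ ≤ cumWeight S i
  cumWeight-nonneg S i = ∑-nonneg n (λ j → if-nonneg _ _ (cityWeight-nonneg S j))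

  cumWeight≤weight : ∀ S i → cumWeight S i ≤ weight S
  cumWeight≤weight S i = ∑-mono n (λ j → if-≤ _ _ (cityWeight-nonneg S j))

  cumWeight-∅ : ∀ i → cumWeight ∅ i ≡ 0ℚ
  cumWeight-∅ i = ∑-zero n (λ j →
    trans (cong (λ z → if ⌊ toℕ j ℕ.≤? toℕ i ⌋ then z else 0ℚ) (∑-zero (m j) (λ l → refl))) (if-zero _))

  cumWeight-∪ : ∀ {A B} → Disjoint A B → ∀ i → cumWeight (A ∪ B) i ≡ cumWeight A i + cumWeight B i
  cumWeight-∪ {A} {B} disj i = trans
    (∑-cong n (λ j → trans (cong (λ z → if before j then z else 0ℚ) (citySum-∪ disj w j))
                           (if-+ (before j) (cityWeight A j) (cityWeight B j))))
    (∑-+ n _ _)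
    where
    before : Fin n → Bool
    before j = ⌊ toℕ j ℕ.≤? toℕ i ⌋

  -- The speed never drops below vmin while the load is at most W.
  ν-nonneg : 0ℚ ≤ ν
  ν-nonneg = ⊘-nonneg _ W (<⇒≤ (<⇒0<- _ _ vmin<vmax)) W-pos

  ν*W : ν * W ≡ vmax - vmin
  ν*W = trans (*-comm ν W) (⊘-cancel (vmax - vmin) W W-pos)

  speed-pos : ∀ c → c ≤ W → 0ℚ < vmax - ν * c
  speed-pos c c≤W = <-≤-trans vmin-pos (0≤-⇒≤ _ _ (subst (0ℚ ≤_) (sym slack) (0≤* ν-nonneg (≤⇒0≤- c W c≤W))))
    where
    slack : (vmax - ν * c) - vmin ≡ ν * (W - c)
    slack = begin
      (vmax - ν * c) - vmin
        ≡⟨ solve 4 (λ vM vm nu c → (vM :- nu :* c) :- vm := (vM :- vm) :- nu :* c) refl vmax vmin ν c ⟩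
      (vmax - vmin) - ν * c
        ≡⟨ cong (_- ν * c) (sym ν*W) ⟩
      ν * W - ν * c
        ≡⟨ solve 3 (λ nu W c → nu :* W :- nu :* c := nu :* (W :- c)) refl ν W c ⟩
      ν * (W - c) ∎
      where open ≡-Reasoning

  legTime : Selection → Fin n → ℚ
  legTime S i = d i ⊘ (vmax - ν * cumWeight S i)

  -- Per leg: the loads of A and B add up, and the reciprocal inequality applies
  -- because the joint load still leaves a positive speed.
  legTime-supermodular : ∀ {A B} → Disjoint A B → weight (A ∪ B) ≤ W → ∀ i →
    legTime A i + legTime B i ≤ legTime (A ∪ B) i + legTime ∅ i
  legTime-supermodular {A} {B} disj fits i =
    subst₂ (λ x y → legTime A i + legTime B i ≤ d i ⊘ x + d i ⊘ y) (sym load-∪) (sym load-∅)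
      (reciprocal-increments (d i) vmax (ν * a) (ν * b) (<⇒≤ (d-pos i))
        (0≤* ν-nonneg (cumWeight-nonneg A i)) (0≤* ν-nonneg (cumWeight-nonneg B i))
        (subst (0ℚ <_) load-∪ (speed-pos _ (≤-trans (cumWeight≤weight (A ∪ B) i) fits))))
    where
    a = cumWeight A i
    b = cumWeight B i
    load-∪ : vmax - ν * cumWeight (A ∪ B) i ≡ vmax - (ν * a + ν * b)
    load-∪ = cong (λ z → vmax - z) (trans (cong (ν *_) (cumWeight-∪ disj i)) (*-distribˡ-+ ν a b))
    load-∅ : vmax - ν * cumWeight ∅ i ≡ vmax
    load-∅ = trans (cong (λ z → vmax - ν * z) (cumWeight-∅ i))
                   (trans (cong (λ z → vmax - z) (*-zeroʳ ν)) (+-identityʳ vmax))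

  t-supermodular : ∀ {A B} → Disjoint A B → weight (A ∪ B) ≤ W → t A + t B ≤ t (A ∪ B) + t ∅
  t-supermodular disj fits =
    subst₂ _≤_ (∑-+ n _ _) (∑-+ n _ _) (∑-mono n (legTime-supermodular disj fits))

  t-increment : ∀ {A B} → Disjoint A B → weight (A ∪ B) ≤ W → t B - t ∅ ≤ t (A ∪ B) - t A
  t-increment {A} {B} disj fits = 0≤-⇒≤ _ _ (subst (0ℚ ≤_) rearrange (≤⇒0≤- _ _ (t-supermodular disj fits)))
    where
    rearrange : (t (A ∪ B) + t ∅) - (t A + t B) ≡ (t (A ∪ B) - t A) - (t B - t ∅)
    rearrange = solve 4 (λ a b c d → (a :+ b) :- (c :+ d) := (a :- c) :- (d :- b)) refl
                  (t (A ∪ B)) (t ∅) (t A) (t B)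

proposition2 : (I : Instance) → let open Instance I in
    (i : Fin n) (k : Fin (m i)) →
    ℕ→ℚ (p i k) ≤ R * (t (isItem i k) - t ∅) →
    (O : Selection) → O i k ≡ false →
    w i k + weight O ≤ W →
    f (insert O i k) ≤ f O
proposition2 I i k p≤R·Δt O Oik≡false fits = 0≤-⇒≤ _ _ (subst (0ℚ ≤_) loss 0≤loss)
  where
  open Instance I
  open Selections I
  e = isItem i k
  pₑ = ℕ→ℚ (p i k)
  profits : (j : Fin n) → Fin (m j) → ℚ
  profits j l = ℕ→ℚ (p j l)
  disj : Disjoint O e
  disj = disjoint-item i k O Oik≡false
  weight-O∪e : weight (O ∪ e) ≡ w i k + weight O
  weight-O∪e = trans (Sum-∪ disj w) (trans (cong (weight O +_) (Sum-item i k w)) (+-comm (weight O) (w i k)))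
  profit-O∪e : profit (O ∪ e) ≡ profit O + pₑ
  profit-O∪e = trans (Sum-∪ disj profits) (cong (profit O +_) (Sum-item i k profits))
  pₑ≤R·ΔtO : pₑ ≤ R * (t (O ∪ e) - t O)
  pₑ≤R·ΔtO = ≤-trans p≤R·Δt (*-monoˡ-≤-nonNeg R {{nonNegative (<⇒≤ R-pos)}}
                (t-increment disj (subst (_≤ W) (sym weight-O∪e) fits)))
  0≤loss : 0ℚ ≤ R * (t (O ∪ e) - t O) - pₑ
  0≤loss = ≤⇒0≤- _ _ pₑ≤R·ΔtO
  loss : R * (t (O ∪ e) - t O) - pₑ ≡ f O - f (O ∪ e)
  loss = trans (solve 5 (λ r tOe tO pO pe → r :* (tOe :- tO) :- pe := (pO :- r :* tO) :- ((pO :+ pe) :- r :* tOe))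
                  refl R (t (O ∪ e)) (t O) (profit O) pₑ)
               (cong (λ z → f O - (z - R * t (O ∪ e))) (sym profit-O∪e))
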